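{- Let $G=(V,E)$ be an undirected graph with positive edge weights and terminal set $T\subseteq V$, let $s\in T$ be such that for every vertex $t\neq s$ the minimum $s$-$t$ cut is unique, and let $\phi$ be real. Suppose $ct(s,\phi)$ partitions the terminals into two nonempty sides $T_1=ct(s,\phi)\cap T$ (the terminals $t$ with $\lambda(s,t)\ge\phi$, together with $s$) and $T_2=T\setminus T_1$ (the terminals with $\lambda(s,t)<\phi$). Let $S$ be the $T_1$-side of the earliest $T_1$-$T_2$ min cut. Then $S$ does not cross any supreme set.
   Context: For $X\subseteq V$, $d(X)$ is the total weight of edges with exactly one endpoint in $X$; $\lambda(s,t)$ is the minimum $s$-$t$ cut value; $ct(s,\phi)=\{t\in V\setminus\{s\}:\lambda(s,t)\ge\phi\}\cup\{s\}$. For disjoint nonempty $A,B\subseteq V$, the earliest $A$-$B$ min cut has $A$-side equal to the inclusion-wise minimal set $S$ with $A\subseteq S\subseteq V\setminus B$ minimizing $d(S)$. A Steiner cut is a set $X$ with $X\cap T\neq\emptyset$, $T\not\subseteq X$; it is extreme if every Steiner cut $Y\subsetneq X$ has $d(Y)>d(X)$. For $R\subseteq T$, the supreme set $\mu(R)$ is the union of all extreme sets $X$ with $X\cap T=R$ (defined only if at least one exists). Sets cross if their intersection and both differences are nonempty.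
   Formalization: The edge weights are rational, and the threshold φ is rational instead of real. -}

module Defs where

open import Data.Nat using (ℕ)
open import Data.Bool using (Bool; true; false; _∧_; not; if_then_else_)
open import Data.Fin using (Fin)
open import Data.Fin.Subset using (Subset; _∈_; _∉_; _⊆_; _⊂_; _∩_; Nonempty)
open import Data.List using (List; foldr; map; allFin)
open import Data.Vec using (lookup)
open import Data.Rational using (ℚ; 0ℚ; _+_; _≤_; _<_)
open import Data.Product using (Σ; ∃; _×_; _,_)
open import Data.Sum using (_⊎_)
open import Relation.Binary.PropositionalEquality using (_≡_; _≢_)
open import Relation.Nullary using (¬_)

-- A weighted undirected graph on vertex set V = Fin n is given by a symmetric
-- weight function w : Fin n → Fin n → ℚ with w u v ≥ 0; the edges are the
-- pairs {u,v}, u ≠ v, with w u v > 0 (so every edge has positive weight).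
record WGraph (n : ℕ) : Set where
  field
    w        : Fin n → Fin n → ℚ
    w-sym    : ∀ u v → w u v ≡ w v u
    w-nonneg : ∀ u v → 0ℚ ≤ w u v
open WGraph public

sumℚ : List ℚ → ℚ
sumℚ = foldr _+_ 0ℚ

-- d(X): total weight of edges with exactly one endpoint in X
-- (each such edge {u,v} is counted once, via the ordered pair with u ∈ X, v ∉ X).
d : ∀ {n} → WGraph n → Subset n → ℚ
d {n} G X =
  sumℚ (map (λ u → sumℚ (map (λ v →
     if lookup X u ∧ not (lookup X v) then w G u v else 0ℚ) (allFin n))) (allFin n))

SepCut : ∀ {n} → Fin n → Fin n → Subset n → Set
SepCut s t X = s ∈ X × t ∉ X

IsMinCut : ∀ {n} → WGraph n → Fin n → Fin n → Subset n → Set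
IsMinCut G s t X = SepCut s t X × (∀ Y → SepCut s t Y → d G X ≤ d G Y)

IsLambda : ∀ {n} → WGraph n → Fin n → Fin n → ℚ → Set
IsLambda G s t c = ∃ λ X → IsMinCut G s t X × d G X ≡ c

InCt : ∀ {n} → WGraph n → Fin n → ℚ → Fin n → Set
InCt G s φ t = t ≡ s ⊎ (t ≢ s × ∃ λ c → IsLambda G s t c × φ ≤ c)

-- S is the A-side of the earliest A-B min cut: the inclusion-wise minimal
-- set among the minimizers of d over {S | A ⊆ S ⊆ V ∖ B}.
Feasible : ∀ {n} → Subset n → Subset n → Subset n → Set
Feasible A B S = A ⊆ S × (∀ {v} → v ∈ B → v ∉ S)

IsABMinCut : ∀ {n} → WGraph n → Subset n → Subset n → Subset n → Set
IsABMinCut G A B S = Feasible A B S × (∀ S′ → Feasible A B S′ → d G S ≤ d G S′)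

IsEarliestMinCut : ∀ {n} → WGraph n → Subset n → Subset n → Subset n → Set
IsEarliestMinCut G A B S =
  IsABMinCut G A B S × (∀ S′ → IsABMinCut G A B S′ → ¬ (S′ ⊂ S))

IsSteinerCut : ∀ {n} → Subset n → Subset n → Set
IsSteinerCut T X = Nonempty (X ∩ T) × ¬ (T ⊆ X)

IsExtreme : ∀ {n} → WGraph n → Subset n → Subset n → Set
IsExtreme G T X =
  IsSteinerCut T X × (∀ Y → IsSteinerCut T Y → Y ⊂ X → d G X < d G Y)

IsSupremeSet : ∀ {n} → WGraph n → Subset n → Subset n → Subset n → Set
IsSupremeSet G T R M =
  (∃ λ X → IsExtreme G T X × X ∩ T ≡ R) ×
  (∀ v → v ∈ M → ∃ λ X → IsExtreme G T X × X ∩ T ≡ R × v ∈ X) ×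
  (∀ v X → IsExtreme G T X → X ∩ T ≡ R → v ∈ X → v ∈ M)

Crosses : ∀ {n} → Subset n → Subset n → Set
Crosses X Y =
  (∃ λ v → v ∈ X × v ∈ Y) × (∃ λ v → v ∈ X × v ∉ Y) × (∃ λ v → v ∈ Y × v ∉ X)

-- Fix an extreme set X with X ∩ T = R; μ(R) is the union of all such X. Uncrossing X with S, by
-- submodularity d(X ∩ S) + d(X ∪ S) ≤ d X + d S or posimodularity d(X ∖ S) + d(S ∖ X) ≤ d X + d S,
-- and using that proper Steiner subsets of X cost more than X while proper feasible subsets of the
-- earliest cut S cost more than S:
--   if R ⊆ T₁, then X ∪ S would be a cheaper T₁-T₂ cut unless X ⊆ S, so μ(R) ⊆ S;
--   if R ⊆ T₂, then S ∖ X would be a cheaper T₁-T₂ cut unless X ∩ S = ∅, so μ(R) ∩ S = ∅;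
--   if T₁ ⊆ R, an inclusion-minimal minimiser of d among the sets Z ⊇ S ∪ X with Z ∩ T = R is
--   extreme, so S ⊆ μ(R).
-- No other case occurs. If R contained t ∈ T₂ and u ∈ T₁, a minimum s-t cut Y has value
-- λ(s,t) < φ, so it contains T₁; uncrossing Y with X shows s ∈ X, and ∁(Y ∖ X) then separates s
-- from every v ∈ T₁ ∖ X at cost below φ ≤ λ(s,v), so T₁ ⊆ R after all.
module Submission where

open import Defs
open import Data.Nat using (ℕ; zero; suc)
import Data.Nat.Properties as ℕ
open import Data.Bool using (Bool; true; false; _∧_; _∨_; not; if_then_else_)
open import Data.Fin using (Fin; zero; suc)
open import Data.Fin.Properties using (any?)
open import Data.Fin.Subset using (Subset; _∈_; _∉_; _⊆_; _⊂_; _∩_; _∪_; ∁; ∣_∣; inside; outside; Nonempty)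
open import Data.Fin.Subset.Properties
  using ( _∈?_; _⊆?_; x∈p∩q⁺; x∈p∩q⁻; x∈p∪q⁻; p⊆p∪q; q⊆p∪q; p∩q⊆p; p∩q⊆q
        ; ⊆-refl; ⊆-reflexive; ⊆-trans; ⊆-antisym; x∈∁p⇒x∉p; x∉p⇒x∈∁p; x∈⁅x⁆; x∈⁅y⁆⇒x≡y
        ; p⊂q⇒∣p∣<∣q∣; ∪-∩-booleanAlgebra; ∪-comm )
import Algebra.Lattice.Properties.BooleanAlgebra as BooleanAlgebra
open import Data.List using (List; [_]; map; _++_; filter; tabulate; allFin)
open import Data.List.Properties using (map-tabulate)
open import Data.List.Membership.Propositional using () renaming (_∈_ to _∈ᴸ_)
open import Data.List.Membership.Propositional.Properties using (∈-map⁺; ∈-++⁺ˡ; ∈-++⁺ʳ; ∈-filter⁺)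
open import Data.List.Relation.Unary.Any using (here)
open import Data.List.Relation.Unary.All using () renaming (lookup to All-lookup)
open import Data.List.Relation.Unary.All.Properties using (all-filter)
import Data.List.Extrema as Extrema
open import Data.Vec using ([]; _∷_; lookup)
open import Data.Vec.Properties using (lookup-zipWith; lookup-map)
open import Data.Rational using (ℚ; 0ℚ; _+_; _≤_; _<_)
import Data.Rational.Properties as ℚ
open import Algebra.Properties.CommutativeMonoid.Sum ℚ.+-0-commutativeMonoid
  using (sum; sum-syntax; ∑-distrib-+; ∑-comm; sum-cong-≗)
open import Data.Product using (∃; _×_; _,_; proj₁; proj₂)
open import Data.Sum using (_⊎_; inj₁; inj₂; [_,_]′)
open import Data.Empty using (⊥-elim)
open import Level using (0ℓ)
open import Relation.Binary.Bundles using (TotalOrder; DecTotalOrder)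
open import Relation.Binary.PropositionalEquality
  using (_≡_; _≢_; refl; sym; trans; cong; cong₂; subst; module ≡-Reasoning)
open import Relation.Nullary using (¬_; yes; no)
open import Relation.Nullary.Decidable using (_×-dec_; ¬?; decidable-stable)
open import Relation.Unary using (Pred; Decidable)

private
  variable
    n : ℕ

-- The cut function d

crossWeight : Bool → Bool → ℚ → ℚ
crossWeight inU inV x = if inU ∧ not inV then x else 0ℚ

cutWeight : WGraph n → Subset n → Fin n → Fin n → ℚ
cutWeight G X u v = crossWeight (lookup X u) (lookup X v) (w G u v)

sumℚ-tabulate : (f : Fin n → ℚ) → sumℚ (tabulate f) ≡ sum f
sumℚ-tabulate {zero}  f = refl
sumℚ-tabulate {suc n} f = cong (f zero +_) (sumℚ-tabulate (λ i → f (suc i)))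

sumℚ-allFin : (f : Fin n → ℚ) → sumℚ (map f (allFin n)) ≡ sum f
sumℚ-allFin f = trans (cong sumℚ (map-tabulate (λ i → i) f)) (sumℚ-tabulate f)

d≡∑∑cutWeight : (G : WGraph n) (X : Subset n) → d G X ≡ ∑[ u < n ] ∑[ v < n ] cutWeight G X u v
d≡∑∑cutWeight {n} G X =
  trans (sumℚ-allFin (λ u → sumℚ (map (cutWeight G X u) (allFin n))))
        (sum-cong-≗ (λ u → sumℚ-allFin (cutWeight G X u)))

∑-mono-≤ : {f g : Fin n → ℚ} → (∀ i → f i ≤ g i) → sum f ≤ sum g
∑-mono-≤ {zero}  f≤g = ℚ.≤-refl
∑-mono-≤ {suc n} f≤g = ℚ.+-mono-≤ (f≤g zero) (∑-mono-≤ (λ i → f≤g (suc i)))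

d+d≡∑∑ : (G : WGraph n) (A B : Subset n) →
         d G A + d G B ≡ ∑[ u < n ] ∑[ v < n ] (cutWeight G A u v + cutWeight G B u v)
d+d≡∑∑ {n} G A B = begin
  d G A + d G B
    ≡⟨ cong₂ _+_ (d≡∑∑cutWeight G A) (d≡∑∑cutWeight G B) ⟩
  ∑[ u < n ] ∑[ v < n ] cutWeight G A u v + ∑[ u < n ] ∑[ v < n ] cutWeight G B u v
    ≡⟨ ∑-distrib-+ (λ u → ∑[ v < n ] cutWeight G A u v) (λ u → ∑[ v < n ] cutWeight G B u v) ⟨
  ∑[ u < n ] (∑[ v < n ] cutWeight G A u v + ∑[ v < n ] cutWeight G B u v)
    ≡⟨ sum-cong-≗ (λ u → ∑-distrib-+ (cutWeight G A u) (cutWeight G B u)) ⟨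
  ∑[ u < n ] ∑[ v < n ] (cutWeight G A u v + cutWeight G B u v) ∎
  where open ≡-Reasoning

d+d-mono-≤ : (G : WGraph n) {A B C D : Subset n} →
  (∀ u v → cutWeight G A u v + cutWeight G B u v ≤ cutWeight G C u v + cutWeight G D u v) →
  d G A + d G B ≤ d G C + d G D
d+d-mono-≤ {n} G {A} {B} {C} {D} pointwise = begin
  d G A + d G B                                                 ≡⟨ d+d≡∑∑ G A B ⟩
  ∑[ u < n ] ∑[ v < n ] (cutWeight G A u v + cutWeight G B u v) ≤⟨ ∑-mono-≤ (λ u → ∑-mono-≤ (pointwise u)) ⟩
  ∑[ u < n ] ∑[ v < n ] (cutWeight G C u v + cutWeight G D u v) ≡⟨ d+d≡∑∑ G C D ⟨
  d G C + d G D                                                 ∎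
  where open ℚ.≤-Reasoning

crossWeight-submodular : ∀ a₁ b₁ a₂ b₂ {x} → 0ℚ ≤ x →
  crossWeight (a₁ ∧ b₁) (a₂ ∧ b₂) x + crossWeight (a₁ ∨ b₁) (a₂ ∨ b₂) x
    ≤ crossWeight a₁ a₂ x + crossWeight b₁ b₂ x
crossWeight-submodular true  true  true  true      _   = ℚ.≤-refl
crossWeight-submodular true  true  true  false {x} _   = ℚ.≤-reflexive (ℚ.+-comm x 0ℚ)
crossWeight-submodular true  true  false true      _   = ℚ.≤-refl
crossWeight-submodular true  true  false false     _   = ℚ.≤-refl
crossWeight-submodular true  false true  _         _   = ℚ.≤-refl
crossWeight-submodular true  false false true      0≤x = ℚ.+-mono-≤ 0≤x ℚ.≤-refl
crossWeight-submodular true  false false false {x} _   = ℚ.≤-reflexive (ℚ.+-comm 0ℚ x)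
crossWeight-submodular false true  true  true      _   = ℚ.≤-refl
crossWeight-submodular false true  true  false     0≤x = ℚ.+-mono-≤ ℚ.≤-refl 0≤x
crossWeight-submodular false true  false true      _   = ℚ.≤-refl
crossWeight-submodular false true  false false     _   = ℚ.≤-refl
crossWeight-submodular false false _     _         _   = ℚ.≤-refl

d-submodular : (G : WGraph n) (A B : Subset n) → d G (A ∩ B) + d G (A ∪ B) ≤ d G A + d G B
d-submodular G A B = d+d-mono-≤ G {A ∩ B} {A ∪ B} {A} {B} pointwise
  where
  pointwise : ∀ u v →
    cutWeight G (A ∩ B) u v + cutWeight G (A ∪ B) u v ≤ cutWeight G A u v + cutWeight G B u v
  pointwise u v
    rewrite lookup-zipWith _∧_ u A B | lookup-zipWith _∧_ v A B
          | lookup-zipWith _∨_ u A B | lookup-zipWith _∨_ v A B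
    = crossWeight-submodular (lookup A u) (lookup B u) (lookup A v) (lookup B v) (w-nonneg G u v)

crossWeight-not : ∀ a b x → crossWeight (not a) (not b) x ≡ crossWeight b a x
crossWeight-not true  true  _ = refl
crossWeight-not true  false _ = refl
crossWeight-not false true  _ = refl
crossWeight-not false false _ = refl

d-∁ : (G : WGraph n) (A : Subset n) → d G (∁ A) ≡ d G A
d-∁ {n} G A = begin
  d G (∁ A)                                   ≡⟨ d≡∑∑cutWeight G (∁ A) ⟩
  ∑[ u < n ] ∑[ v < n ] cutWeight G (∁ A) u v ≡⟨ sum-cong-≗ (λ u → sum-cong-≗ (pointwise u)) ⟩
  ∑[ u < n ] ∑[ v < n ] cutWeight G A v u     ≡⟨ ∑-comm (λ u v → cutWeight G A v u) ⟩
  ∑[ v < n ] ∑[ u < n ] cutWeight G A v u     ≡⟨ d≡∑∑cutWeight G A ⟨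
  d G A                                       ∎
  where
  open ≡-Reasoning
  pointwise : ∀ u v → cutWeight G (∁ A) u v ≡ cutWeight G A v u
  pointwise u v
    rewrite lookup-map u not A | lookup-map v not A | w-sym G u v
    = crossWeight-not (lookup A u) (lookup A v) (w G v u)

d-posimodular : (G : WGraph n) (A B : Subset n) → d G (A ∩ ∁ B) + d G (B ∩ ∁ A) ≤ d G A + d G B
d-posimodular {n} G A B = begin
  d G (A ∩ ∁ B) + d G (B ∩ ∁ A)
    ≡⟨ cong (d G (A ∩ ∁ B) +_) (trans (sym (d-∁ G (B ∩ ∁ A))) (cong (d G) ∁[B∩∁A]≡A∪∁B)) ⟩
  d G (A ∩ ∁ B) + d G (A ∪ ∁ B)   ≤⟨ d-submodular G A (∁ B) ⟩
  d G A + d G (∁ B)               ≡⟨ cong (d G A +_) (d-∁ G B) ⟩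
  d G A + d G B                   ∎
  where
  open ℚ.≤-Reasoning
  open BooleanAlgebra (∪-∩-booleanAlgebra n) using (deMorgan₁; ¬-involutive)
  ∁[B∩∁A]≡A∪∁B : ∁ (B ∩ ∁ A) ≡ A ∪ ∁ B
  ∁[B∩∁A]≡A∪∁B = trans (deMorgan₁ B (∁ A)) (trans (cong (∁ B ∪_) (¬-involutive A)) (∪-comm (∁ B) A))

-- Minimisers over all subsets

subsets : ∀ n → List (Subset n)
subsets zero    = [ [] ]
subsets (suc n) = map (inside ∷_) (subsets n) ++ map (outside ∷_) (subsets n)

∈-subsets : (p : Subset n) → p ∈ᴸ subsets n
∈-subsets []                    = here refl
∈-subsets (inside ∷ p)          = ∈-++⁺ˡ (∈-map⁺ (inside ∷_) (∈-subsets p))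
∈-subsets {suc n} (outside ∷ p) = ∈-++⁺ʳ (map (inside ∷_) (subsets n)) (∈-map⁺ (outside ∷_) (∈-subsets p))

module _ {b ℓ₁ ℓ₂} (O : TotalOrder b ℓ₁ ℓ₂) where
  open TotalOrder O using (Carrier) renaming (_≤_ to _≼_)
  open Extrema O using (argmin; argmin-all; f[argmin]≤f[xs])

  ∃-minimiser : (f : Subset n → Carrier) {P : Pred (Subset n) 0ℓ} → Decidable P →
                ∀ {Z₀} → P Z₀ → ∃ λ Z → P Z × (∀ W → P W → f Z ≼ f W)
  ∃-minimiser {n} f P? {Z₀} Z₀∈P =
      argmin f Z₀ candidates
    , argmin-all f Z₀∈P (all-filter P? (subsets n))
    , λ W W∈P → All-lookup (f[argmin]≤f[xs] Z₀ candidates) (∈-filter⁺ P? (∈-subsets W) W∈P)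
    where
    candidates = filter P? (subsets n)

-- IsMinCut G s t and IsEarliestMinCut G A B unfold to Minimises (d G) (SepCut s t) and
-- MinimalMinimiser (d G) (Feasible A B).
Minimises : (Subset n → ℚ) → Pred (Subset n) 0ℓ → Subset n → Set
Minimises f P Z = P Z × (∀ W → P W → f Z ≤ f W)

MinimalMinimiser : (Subset n → ℚ) → Pred (Subset n) 0ℓ → Subset n → Set
MinimalMinimiser f P Z = Minimises f P Z × (∀ W → Minimises f P W → ¬ W ⊂ Z)

∃-Minimises : (f : Subset n → ℚ) {P : Pred (Subset n) 0ℓ} → Decidable P → ∀ {Z₀} → P Z₀ → ∃ (Minimises f P)
∃-Minimises = ∃-minimiser (DecTotalOrder.totalOrder ℚ.≤-decTotalOrder)

-- Among the minimisers of f, one of least cardinality is inclusion-minimal.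
∃-MinimalMinimiser : (f : Subset n → ℚ) {P : Pred (Subset n) 0ℓ} → Decidable P →
                     ∀ {Z₀} → P Z₀ → ∃ (MinimalMinimiser f P)
∃-MinimalMinimiser f {P} P? Z₀∈P =
  let Z₁ , Z₁∈P , Z₁-min = ∃-Minimises f P? Z₀∈P
      Z , (Z∈P , fZ≤fZ₁) , Z-smallest =
        ∃-minimiser ℕ.≤-totalOrder ∣_∣ {λ W → P W × f W ≤ f Z₁} (λ W → P? W ×-dec f W ℚ.≤? f Z₁) (Z₁∈P , ℚ.≤-refl)
  in Z , (Z∈P , λ W W∈P → ℚ.≤-trans fZ≤fZ₁ (Z₁-min W W∈P)) ,
     λ W (W∈P , W-min) W⊂Z → ℕ.<⇒≱ (p⊂q⇒∣p∣<∣q∣ W⊂Z) (Z-smallest W (W∈P , W-min Z₁ Z₁∈P))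

minimalMinimiser-< : {f : Subset n → ℚ} {P : Pred (Subset n) 0ℓ} {Z Y : Subset n} →
                     MinimalMinimiser f P Z → P Y → Y ⊂ Z → f Z < f Y
minimalMinimiser-< {Y = Y} ((_ , Z-min) , Z-minimal) Y∈P Y⊂Z =
  ℚ.≰⇒> λ fY≤fZ → Z-minimal Y (Y∈P , λ W W∈P → ℚ.≤-trans fY≤fZ (Z-min W W∈P)) Y⊂Z

-- Uncrossing with extreme sets and minimum cuts

+-cancel-< : ∀ {a b c e : ℚ} → a + b ≤ c + e → c < a → b < e
+-cancel-< a+b≤c+e c<a = ℚ.≰⇒> λ e≤b → ℚ.<-irrefl refl (ℚ.<-≤-trans (ℚ.+-mono-<-≤ c<a e≤b) a+b≤c+e)

+-cancel-≤ : ∀ {a b c e : ℚ} → a + b ≤ c + e → c ≤ a → b ≤ e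
+-cancel-≤ a+b≤c+e c≤a = ℚ.≮⇒≥ λ e<b → ℚ.<-irrefl refl (ℚ.<-≤-trans (ℚ.+-mono-≤-< c≤a e<b) a+b≤c+e)

<⇒≱ : ∀ {a b : ℚ} → a < b → ¬ b ≤ a
<⇒≱ a<b b≤a = ℚ.<-irrefl refl (ℚ.<-≤-trans a<b b≤a)

⊆-or-∃∉ : (p q : Subset n) → p ⊆ q ⊎ ∃ λ x → x ∈ p × x ∉ q
⊆-or-∃∉ p q with any? (λ x → x ∈? p ×-dec ¬? (x ∈? q))
... | yes ∃∉ = inj₂ ∃∉
... | no ¬∃∉ = inj₁ λ {x} x∈p → decidable-stable (x ∈? q) λ x∉q → ¬∃∉ (x , x∈p , x∉q)

⊆⇒∩⊆ : {p q r s : Subset n} → p ⊆ q → q ∩ r ⊆ s → p ∩ r ⊆ s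
⊆⇒∩⊆ {p = p} {r = r} p⊆q q∩r⊆s x∈p∩r with x∈p∩q⁻ p r x∈p∩r
... | x∈p , x∈r = q∩r⊆s (x∈p∩q⁺ (p⊆q x∈p , x∈r))

∪-∩-lub : {p q r s : Subset n} → p ∩ r ⊆ s → q ∩ r ⊆ s → (p ∪ q) ∩ r ⊆ s
∪-∩-lub {p = p} {q} {r} p∩r⊆s q∩r⊆s x∈p∪q∩r with x∈p∩q⁻ (p ∪ q) r x∈p∪q∩r
... | x∈p∪q , x∈r with x∈p∪q⁻ p q x∈p∪q
...   | inj₁ x∈p = p∩r⊆s (x∈p∩q⁺ (x∈p , x∈r))
...   | inj₂ x∈q = q∩r⊆s (x∈p∩q⁺ (x∈q , x∈r))

terminalSet⊆ : {T X R : Subset n} → X ∩ T ≡ R → R ⊆ X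
terminalSet⊆ {T = T} {X} X∩T≡R = ⊆-trans (⊆-reflexive (sym X∩T≡R)) (p∩q⊆p X T)

steiner-⊆ : {T X Y : Subset n} {t : Fin n} → IsSteinerCut T X → Y ⊆ X → t ∈ Y → t ∈ T → IsSteinerCut T Y
steiner-⊆ (_ , T⊈X) Y⊆X t∈Y t∈T = (_ , x∈p∩q⁺ (t∈Y , t∈T)) , λ T⊆Y → T⊈X (⊆-trans T⊆Y Y⊆X)

steiner-⊇ : {T X Z : Subset n} → IsSteinerCut T X → X ⊆ Z → Z ∩ T ⊆ X → IsSteinerCut T Z
steiner-⊇ {T = T} {X} ((t , t∈X∩T) , T⊈X) X⊆Z Z∩T⊆X =
  (t , x∈p∩q⁺ (X⊆Z (proj₁ (x∈p∩q⁻ X T t∈X∩T)) , proj₂ (x∈p∩q⁻ X T t∈X∩T))) ,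
  λ T⊆Z → T⊈X (λ t∈T → Z∩T⊆X (x∈p∩q⁺ (T⊆Z t∈T , t∈T)))

extreme-∪-< : (G : WGraph n) {T X Y : Subset n} {x : Fin n} → IsExtreme G T X →
              IsSteinerCut T (X ∩ Y) → x ∈ X → x ∉ Y → d G (X ∪ Y) < d G Y
extreme-∪-< G {X = X} {Y} (_ , X-extreme) X∩Y-steiner x∈X x∉Y =
  +-cancel-< (d-submodular G X Y)
    (X-extreme (X ∩ Y) X∩Y-steiner (p∩q⊆p X Y , _ , x∈X , λ x∈X∩Y → x∉Y (proj₂ (x∈p∩q⁻ X Y x∈X∩Y))))

extreme-∖-< : (G : WGraph n) {T X Y : Subset n} {x : Fin n} → IsExtreme G T X →
              IsSteinerCut T (X ∩ ∁ Y) → x ∈ X → x ∈ Y → d G (Y ∩ ∁ X) < d G Y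
extreme-∖-< G {X = X} {Y} (_ , X-extreme) X∖Y-steiner x∈X x∈Y =
  +-cancel-< (d-posimodular G X Y)
    (X-extreme (X ∩ ∁ Y) X∖Y-steiner
      (p∩q⊆p X (∁ Y) , _ , x∈X , λ x∈X∖Y → x∈∁p⇒x∉p (proj₂ (x∈p∩q⁻ X (∁ Y) x∈X∖Y)) x∈Y))

minimiser-∪-≤ : (G : WGraph n) {P : Pred (Subset n) 0ℓ} {S W : Subset n} →
                Minimises (d G) P S → P (S ∩ W) → d G (S ∪ W) ≤ d G W
minimiser-∪-≤ G {S = S} {W} (_ , S-min) S∩W∈P = +-cancel-≤ (d-submodular G S W) (S-min (S ∩ W) S∩W∈P)

minimalMinimiser-∪-< : (G : WGraph n) {P : Pred (Subset n) 0ℓ} {S W : Subset n} {x : Fin n} →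
                       MinimalMinimiser (d G) P S → P (S ∩ W) → x ∈ S → x ∉ W → d G (S ∪ W) < d G W
minimalMinimiser-∪-< G {S = S} {W} S-mm S∩W∈P x∈S x∉W =
  +-cancel-< (d-submodular G S W)
    (minimalMinimiser-< S-mm S∩W∈P (p∩q⊆p S W , _ , x∈S , λ x∈S∩W → x∉W (proj₂ (x∈p∩q⁻ S W x∈S∩W))))

feasible-∩ : {A B S W : Subset n} → Feasible A B S → A ⊆ W → Feasible A B (S ∩ W)
feasible-∩ {S = S} {W} (A⊆S , B∌S) A⊆W =
  (λ a∈A → x∈p∩q⁺ (A⊆S a∈A , A⊆W a∈A)) , λ b∈B b∈S∩W → B∌S b∈B (proj₁ (x∈p∩q⁻ S W b∈S∩W))

feasible-∪ : {A B S W : Subset n} → Feasible A B S → (∀ {v} → v ∈ B → v ∉ W) → Feasible A B (W ∪ S)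
feasible-∪ {S = S} {W} (A⊆S , B∌S) B∌W =
  ⊆-trans A⊆S (q⊆p∪q W S) , λ b∈B b∈W∪S → [ B∌W b∈B , B∌S b∈B ]′ (x∈p∪q⁻ W S b∈W∪S)

feasible-∖ : {A B S W : Subset n} → Feasible A B S → (∀ {v} → v ∈ A → v ∉ W) → Feasible A B (S ∩ ∁ W)
feasible-∖ {S = S} {W} (A⊆S , B∌S) A∌W =
  (λ a∈A → x∈p∩q⁺ (A⊆S a∈A , x∉p⇒x∈∁p (A∌W a∈A))) , λ b∈B b∈S∖W → B∌S b∈B (proj₁ (x∈p∩q⁻ S (∁ W) b∈S∖W))

extreme⊆minCut : (G : WGraph n) {T A B S X : Subset n} → IsABMinCut G A B S → IsExtreme G T X →
                 X ∩ T ⊆ A → (∀ {v} → v ∈ B → v ∉ X) → X ⊆ S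
extreme⊆minCut G {T} {S = S} {X} (S-feasible , S-min) X-extreme@(((t , t∈X∩T) , _) , _) X∩T⊆A B∌X {x} x∈X =
  decidable-stable (x ∈? S) λ x∉S →
    <⇒≱ (extreme-∪-< G X-extreme X∩S-steiner x∈X x∉S) (S-min (X ∪ S) (feasible-∪ S-feasible B∌X))
  where
  X∩S-steiner : IsSteinerCut T (X ∩ S)
  X∩S-steiner = steiner-⊆ (proj₁ X-extreme) (p∩q⊆p X S)
    (x∈p∩q⁺ (proj₁ (x∈p∩q⁻ X T t∈X∩T) , proj₁ S-feasible (X∩T⊆A t∈X∩T))) (proj₂ (x∈p∩q⁻ X T t∈X∩T))

extreme∩minCut≡∅ : (G : WGraph n) {T A B S X : Subset n} {x : Fin n} → IsABMinCut G A B S → IsExtreme G T X →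
                   X ∩ T ⊆ B → (∀ {v} → v ∈ A → v ∉ X) → x ∈ X → x ∉ S
extreme∩minCut≡∅ G {T} {S = S} {X} (S-feasible , S-min) X-extreme@(((t , t∈X∩T) , _) , _) X∩T⊆B A∌X x∈X x∈S =
  <⇒≱ (extreme-∖-< G X-extreme X∖S-steiner x∈X x∈S) (S-min (S ∩ ∁ X) (feasible-∖ S-feasible A∌X))
  where
  X∖S-steiner : IsSteinerCut T (X ∩ ∁ S)
  X∖S-steiner = steiner-⊆ (proj₁ X-extreme) (p∩q⊆p X (∁ S))
    (x∈p∩q⁺ (proj₁ (x∈p∩q⁻ X T t∈X∩T) , x∉p⇒x∈∁p (proj₂ S-feasible (X∩T⊆B t∈X∩T)))) (proj₂ (x∈p∩q⁻ X T t∈X∩T))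

Enclosing : Subset n → Subset n → Subset n → Pred (Subset n) 0ℓ
Enclosing T S X Z = S ⊆ Z × X ⊆ Z × Z ∩ T ⊆ X

enclosing? : (T S X : Subset n) → Decidable (Enclosing T S X)
enclosing? T S X Z = S ⊆? Z ×-dec X ⊆? Z ×-dec Z ∩ T ⊆? X

∪-enclosing : {T S X W : Subset n} → S ∩ T ⊆ X → X ⊆ W → W ∩ T ⊆ X → Enclosing T S X (S ∪ W)
∪-enclosing {S = S} {W = W} S∩T⊆X X⊆W W∩T⊆X = p⊆p∪q W , ⊆-trans X⊆W (q⊆p∪q S W) , ∪-∩-lub S∩T⊆X W∩T⊆X

-- A Steiner set Y ⊂ Z is uncrossed first with X and then with S; the result encloses S ∪ X,
-- costs at most d Y, and strictly less unless Y itself encloses S ∪ X.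
minimalEnclosing-extreme : (G : WGraph n) {T A B S X Z : Subset n} →
  IsEarliestMinCut G A B S → IsExtreme G T X → A ⊆ X → S ∩ T ⊆ X →
  MinimalMinimiser (d G) (Enclosing T S X) Z → IsExtreme G T Z
minimalEnclosing-extreme G {T} {A} {B} {S} {X} {Z} S-earliest X-extreme A⊆X S∩T⊆X
                         Z-mm@(((_ , X⊆Z , Z∩T⊆X) , Z-min) , _) =
  steiner-⊇ (proj₁ X-extreme) X⊆Z Z∩T⊆X , below-proper-subsets
  where
  S-feasible : Feasible A B S
  S-feasible = proj₁ (proj₁ S-earliest)

  below-proper-subsets : ∀ Y → IsSteinerCut T Y → Y ⊂ Z → d G Z < d G Y
  below-proper-subsets Y ((y , y∈Y∩T) , _) Y⊂Z@(Y⊆Z , _) with ⊆-or-∃∉ X Y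
  ... | inj₂ (x , x∈X , x∉Y) = begin-strict
    d G Z             ≤⟨ Z-min (S ∪ (X ∪ Y)) (∪-enclosing S∩T⊆X (p⊆p∪q Y) (∪-∩-lub (p∩q⊆p X T) Y∩T⊆X)) ⟩
    d G (S ∪ (X ∪ Y)) ≤⟨ minimiser-∪-≤ G (proj₁ S-earliest) (feasible-∩ S-feasible (⊆-trans A⊆X (p⊆p∪q Y))) ⟩
    d G (X ∪ Y)       <⟨ extreme-∪-< G X-extreme X∩Y-steiner x∈X x∉Y ⟩
    d G Y             ∎
    where
    open ℚ.≤-Reasoning
    Y∩T⊆X : Y ∩ T ⊆ X
    Y∩T⊆X = ⊆⇒∩⊆ Y⊆Z Z∩T⊆X
    X∩Y-steiner : IsSteinerCut T (X ∩ Y)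
    X∩Y-steiner = steiner-⊆ (proj₁ X-extreme) (p∩q⊆p X Y)
      (x∈p∩q⁺ (Y∩T⊆X y∈Y∩T , proj₁ (x∈p∩q⁻ Y T y∈Y∩T))) (proj₂ (x∈p∩q⁻ Y T y∈Y∩T))
  ... | inj₁ X⊆Y with ⊆-or-∃∉ S Y
  ...   | inj₁ S⊆Y = minimalMinimiser-< Z-mm (S⊆Y , X⊆Y , ⊆⇒∩⊆ Y⊆Z Z∩T⊆X) Y⊂Z
  ...   | inj₂ (x , x∈S , x∉Y) = begin-strict
    d G Z       ≤⟨ Z-min (S ∪ Y) (∪-enclosing S∩T⊆X X⊆Y (⊆⇒∩⊆ Y⊆Z Z∩T⊆X)) ⟩
    d G (S ∪ Y) <⟨ minimalMinimiser-∪-< G S-earliest (feasible-∩ S-feasible (⊆-trans A⊆X X⊆Y)) x∈S x∉Y ⟩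
    d G Y       ∎
    where open ℚ.≤-Reasoning

earliest⊆extreme : (G : WGraph n) {T A B S X : Subset n} →
  IsEarliestMinCut G A B S → IsExtreme G T X → A ⊆ X → S ∩ T ⊆ X →
  ∃ λ Z → IsExtreme G T Z × S ⊆ Z × Z ∩ T ≡ X ∩ T
earliest⊆extreme G {T} {S = S} {X} S-earliest X-extreme A⊆X S∩T⊆X =
  extend (∃-MinimalMinimiser (d G) (enclosing? T S X) (∪-enclosing S∩T⊆X ⊆-refl (p∩q⊆p X T)))
  where
  extend : ∃ (MinimalMinimiser (d G) (Enclosing T S X)) → ∃ λ Z → IsExtreme G T Z × S ⊆ Z × Z ∩ T ≡ X ∩ T
  extend (Z , Z-mm@(((S⊆Z , X⊆Z , Z∩T⊆X) , _) , _)) =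
    Z , minimalEnclosing-extreme G S-earliest X-extreme A⊆X S∩T⊆X Z-mm , S⊆Z ,
    ⊆-antisym (λ z∈Z∩T → x∈p∩q⁺ (Z∩T⊆X z∈Z∩T , proj₂ (x∈p∩q⁻ Z T z∈Z∩T))) (⊆⇒∩⊆ X⊆Z ⊆-refl)

-- Thresholds on λ(s, t)

InCt⇒φ≤cut : (G : WGraph n) {s t : Fin n} {φ : ℚ} {C : Subset n} → InCt G s φ t → SepCut s t C → φ ≤ d G C
InCt⇒φ≤cut _ (inj₁ refl) (s∈C , s∉C) = ⊥-elim (s∉C s∈C)
InCt⇒φ≤cut G {C = C} (inj₂ (_ , _ , (_ , (_ , X-min) , dX≡c) , φ≤c)) C-cut =
  ℚ.≤-trans φ≤c (subst (_≤ d G C) dX≡c (X-min C C-cut))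

ct⊆cheapCut : (G : WGraph n) {s t : Fin n} {φ : ℚ} {C : Subset n} → s ∈ C → d G C < φ → InCt G s φ t → t ∈ C
ct⊆cheapCut G {t = t} {C = C} s∈C dC<φ t∈ct =
  decidable-stable (t ∈? C) λ t∉C → <⇒≱ dC<φ (InCt⇒φ≤cut G t∈ct (s∈C , t∉C))

minCut<φ : (G : WGraph n) {s t : Fin n} {φ : ℚ} {Y : Subset n} →
           t ≢ s → ¬ InCt G s φ t → IsMinCut G s t Y → d G Y < φ
minCut<φ G t≢s t∉ct Y-min = ℚ.≰⇒> λ φ≤dY → t∉ct (inj₂ (t≢s , _ , (_ , Y-min , refl) , φ≤dY))

minCut-exists : (G : WGraph n) {s t : Fin n} → s ≢ t → ∃ (IsMinCut G s t)
minCut-exists G {s} {t} s≢t =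
  ∃-Minimises (d G) (λ Y → s ∈? Y ×-dec ¬? (t ∈? Y)) (x∈⁅x⁆ s , λ t∈⁅s⁆ → s≢t (sym (x∈⁅y⁆⇒x≡y s t∈⁅s⁆)))

-- Uncrossing makes Y ∖ X cheaper than Y, so by minimality of Y it cannot separate s from t:
-- s ∈ X. Then Y and ∁(Y ∖ X) are both cuts around s cheaper than φ, so both contain v, and v ∈ X.
extreme⊇ct : (G : WGraph n) {T X Y : Subset n} {s t u v : Fin n} {φ : ℚ} → IsExtreme G T X →
  IsMinCut G s t Y → d G Y < φ → t ∈ X → t ∈ T → u ∈ X → u ∈ Y → InCt G s φ v → v ∈ X
extreme⊇ct G {T} {X} {Y} {s} {t} {v = v} {φ} X-extreme ((s∈Y , t∉Y) , Y-min) dY<φ t∈X t∈T u∈X u∈Y v∈ct =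
  decidable-stable (v ∈? X) λ v∉X →
    x∈∁p⇒x∉p (ct⊆cheapCut G s∉Y∖X dY∖X<φ v∈ct) (x∈p∩q⁺ (ct⊆cheapCut G s∈Y dY<φ v∈ct , x∉p⇒x∈∁p v∉X))
  where
  dY∖X<dY : d G (Y ∩ ∁ X) < d G Y
  dY∖X<dY = extreme-∖-< G X-extreme
    (steiner-⊆ (proj₁ X-extreme) (p∩q⊆p X (∁ Y)) (x∈p∩q⁺ (t∈X , x∉p⇒x∈∁p t∉Y)) t∈T) u∈X u∈Y
  s∈X : s ∈ X
  s∈X = decidable-stable (s ∈? X) λ s∉X → <⇒≱ dY∖X<dY
    (Y-min (Y ∩ ∁ X) (x∈p∩q⁺ (s∈Y , x∉p⇒x∈∁p s∉X) , λ t∈Y∖X → t∉Y (proj₁ (x∈p∩q⁻ Y (∁ X) t∈Y∖X))))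
  s∉Y∖X : s ∈ ∁ (Y ∩ ∁ X)
  s∉Y∖X = x∉p⇒x∈∁p λ s∈Y∖X → x∈∁p⇒x∉p (proj₂ (x∈p∩q⁻ Y (∁ X) s∈Y∖X)) s∈X
  dY∖X<φ : d G (∁ (Y ∩ ∁ X)) < φ
  dY∖X<φ = ℚ.<-trans (subst (_< d G Y) (sym (d-∁ G (Y ∩ ∁ X))) dY∖X<dY) dY<φ

⊆⇒¬Crosses : {X Y : Subset n} → X ⊆ Y → ¬ Crosses X Y
⊆⇒¬Crosses X⊆Y (_ , (_ , x∈X , x∉Y) , _) = x∉Y (X⊆Y x∈X)

⊇⇒¬Crosses : {X Y : Subset n} → Y ⊆ X → ¬ Crosses X Y
⊇⇒¬Crosses Y⊆X (_ , _ , (_ , y∈Y , y∉X)) = y∉X (Y⊆X y∈Y)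

disjoint⇒¬Crosses : {X Y : Subset n} → (∀ {v} → v ∈ Y → v ∉ X) → ¬ Crosses X Y
disjoint⇒¬Crosses Y∌X ((_ , v∈X , v∈Y) , _) = Y∌X v∈Y v∈X

module ThresholdPartition (G : WGraph n) {T : Subset n} {s : Fin n} {φ : ℚ} {T₁ T₂ : Subset n}
  (s∈T : s ∈ T)
  (T₁-spec : ∀ t → (t ∈ T₁ → t ∈ T × InCt G s φ t) × (t ∈ T × InCt G s φ t → t ∈ T₁))
  (T₂-spec : ∀ t → (t ∈ T₂ → t ∈ T × t ∉ T₁) × (t ∈ T × t ∉ T₁ → t ∈ T₂))
  where

  s∈T₁ : s ∈ T₁
  s∈T₁ = proj₂ (T₁-spec s) (s∈T , inj₁ refl)

  T₁⊆T : T₁ ⊆ T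
  T₁⊆T t∈T₁ = proj₁ (proj₁ (T₁-spec _) t∈T₁)

  T₁⊆ct : ∀ {t} → t ∈ T₁ → InCt G s φ t
  T₁⊆ct t∈T₁ = proj₂ (proj₁ (T₁-spec _) t∈T₁)

  T₂⊆T : T₂ ⊆ T
  T₂⊆T t∈T₂ = proj₁ (proj₁ (T₂-spec _) t∈T₂)

  T₂∌T₁ : ∀ {t} → t ∈ T₂ → t ∉ T₁
  T₂∌T₁ t∈T₂ = proj₂ (proj₁ (T₂-spec _) t∈T₂)

  T∖T₁⊆T₂ : ∀ {t} → t ∈ T → t ∉ T₁ → t ∈ T₂
  T∖T₁⊆T₂ t∈T t∉T₁ = proj₂ (T₂-spec _) (t∈T , t∉T₁)

  T∖T₂⊆T₁ : ∀ {t} → t ∈ T → t ∉ T₂ → t ∈ T₁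
  T∖T₂⊆T₁ {t} t∈T t∉T₂ = decidable-stable (t ∈? T₁) λ t∉T₁ → t∉T₂ (T∖T₁⊆T₂ t∈T t∉T₁)

  feasible∩T⊆T₁ : {S : Subset n} → Feasible T₁ T₂ S → S ∩ T ⊆ T₁
  feasible∩T⊆T₁ {S} (_ , T₂∌S) t∈S∩T =
    T∖T₂⊆T₁ (proj₂ (x∈p∩q⁻ S T t∈S∩T)) λ t∈T₂ → T₂∌S t∈T₂ (proj₁ (x∈p∩q⁻ S T t∈S∩T))

  extreme⊇T₁ : {X : Subset n} {t u : Fin n} → IsExtreme G T X → t ∈ X → t ∈ T₂ → u ∈ X → u ∈ T₁ → T₁ ⊆ X
  extreme⊇T₁ {X} {t} X-extreme t∈X t∈T₂ u∈X u∈T₁ = through (minCut-exists G s≢t)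
    where
    s≢t : s ≢ t
    s≢t s≡t = T₂∌T₁ t∈T₂ (subst (_∈ T₁) s≡t s∈T₁)
    t∉ct : ¬ InCt G s φ t
    t∉ct t∈ct = T₂∌T₁ t∈T₂ (proj₂ (T₁-spec t) (T₂⊆T t∈T₂ , t∈ct))
    through : ∃ (IsMinCut G s t) → T₁ ⊆ X
    through (Y , Y-min@((s∈Y , _) , _)) v∈T₁ =
      extreme⊇ct G X-extreme Y-min dY<φ t∈X (T₂⊆T t∈T₂) u∈X (ct⊆cheapCut G s∈Y dY<φ (T₁⊆ct u∈T₁)) (T₁⊆ct v∈T₁)
      where
      dY<φ : d G Y < φ
      dY<φ = minCut<φ G (λ t≡s → s≢t (sym t≡s)) t∉ct Y-min

  supreme-terminals : {R M : Subset n} → IsSupremeSet G T R M → T₁ ⊆ R ⊎ R ⊆ T₁ ⊎ R ⊆ T₂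
  supreme-terminals {R} ((X , X-extreme , X∩T≡R) , _) with ⊆-or-∃∉ R T₁ | ⊆-or-∃∉ R T₂
  ... | inj₁ R⊆T₁ | _         = inj₂ (inj₁ R⊆T₁)
  ... | inj₂ _    | inj₁ R⊆T₂ = inj₂ (inj₂ R⊆T₂)
  ... | inj₂ (t , t∈R , t∉T₁) | inj₂ (u , u∈R , u∉T₂) = inj₁ (⊆-trans T₁⊆X∩T (⊆-reflexive X∩T≡R))
    where
    R⊆T : R ⊆ T
    R⊆T = ⊆-trans (⊆-reflexive (sym X∩T≡R)) (p∩q⊆q X T)
    T₁⊆X∩T : T₁ ⊆ X ∩ T
    T₁⊆X∩T v∈T₁ = x∈p∩q⁺
      ( extreme⊇T₁ X-extreme (terminalSet⊆ X∩T≡R t∈R) (T∖T₁⊆T₂ (R⊆T t∈R) t∉T₁)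
                             (terminalSet⊆ X∩T≡R u∈R) (T∖T₂⊆T₁ (R⊆T u∈R) u∉T₂) v∈T₁
      , T₁⊆T v∈T₁ )

  earliest⊆supreme : {S R M : Subset n} → IsEarliestMinCut G T₁ T₂ S → IsSupremeSet G T R M → T₁ ⊆ R → S ⊆ M
  earliest⊆supreme {S} S-earliest ((X , X-extreme , X∩T≡R) , _ , extreme⊆M) T₁⊆R v∈S =
    let Z , Z-extreme , S⊆Z , Z∩T≡X∩T = earliest⊆extreme G S-earliest X-extreme T₁⊆X S∩T⊆X
    in extreme⊆M _ Z Z-extreme (trans Z∩T≡X∩T X∩T≡R) (S⊆Z v∈S)
    where
    T₁⊆X : T₁ ⊆ X
    T₁⊆X = ⊆-trans T₁⊆R (terminalSet⊆ X∩T≡R)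
    S∩T⊆X : S ∩ T ⊆ X
    S∩T⊆X = ⊆-trans (feasible∩T⊆T₁ (proj₁ (proj₁ S-earliest))) T₁⊆X

  supreme⊆minCut : {S R M : Subset n} → IsABMinCut G T₁ T₂ S → IsSupremeSet G T R M → R ⊆ T₁ → M ⊆ S
  supreme⊆minCut S-min (_ , M⊆extreme , _) R⊆T₁ v∈M =
    let X , X-extreme , X∩T≡R , v∈X = M⊆extreme _ v∈M
        X∩T⊆T₁ = ⊆-trans (⊆-reflexive X∩T≡R) R⊆T₁
    in extreme⊆minCut G S-min X-extreme X∩T⊆T₁
         (λ t∈T₂ t∈X → T₂∌T₁ t∈T₂ (X∩T⊆T₁ (x∈p∩q⁺ (t∈X , T₂⊆T t∈T₂)))) v∈X

  supreme∩minCut≡∅ : {S R M : Subset n} {v : Fin n} → IsABMinCut G T₁ T₂ S → IsSupremeSet G T R M →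
                     R ⊆ T₂ → v ∈ M → v ∉ S
  supreme∩minCut≡∅ S-min (_ , M⊆extreme , _) R⊆T₂ v∈M =
    let X , X-extreme , X∩T≡R , v∈X = M⊆extreme _ v∈M
        X∩T⊆T₂ = ⊆-trans (⊆-reflexive X∩T≡R) R⊆T₂
    in extreme∩minCut≡∅ G S-min X-extreme X∩T⊆T₂
         (λ t∈T₁ t∈X → T₂∌T₁ (X∩T⊆T₂ (x∈p∩q⁺ (t∈X , T₁⊆T t∈T₁))) t∈T₁) v∈X

mainTheorem11 : ∀ {n} (G : WGraph n) (T : Subset n) (s : Fin n) (φ : ℚ)
    → s ∈ T
    → (∀ t → t ≢ s → ∀ X Y → IsMinCut G s t X → IsMinCut G s t Y → X ≡ Y)
    → (T₁ T₂ : Subset n)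
    → (∀ t → (t ∈ T₁ → t ∈ T × InCt G s φ t) × (t ∈ T × InCt G s φ t → t ∈ T₁))
    → (∀ t → (t ∈ T₂ → t ∈ T × t ∉ T₁) × (t ∈ T × t ∉ T₁ → t ∈ T₂))
    → Nonempty T₁
    → Nonempty T₂
    → (S : Subset n)
    → IsEarliestMinCut G T₁ T₂ S
    → ∀ R M → IsSupremeSet G T R M → ¬ Crosses S M
mainTheorem11 G T s φ s∈T _ T₁ T₂ T₁-spec T₂-spec _ _ S S-earliest R M M-supreme =
  [ (λ (T₁⊆R : T₁ ⊆ R) → ⊆⇒¬Crosses (earliest⊆supreme S-earliest M-supreme T₁⊆R))
  , [ (λ (R⊆T₁ : R ⊆ T₁) → ⊇⇒¬Crosses (supreme⊆minCut S-min M-supreme R⊆T₁))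
    , (λ (R⊆T₂ : R ⊆ T₂) → disjoint⇒¬Crosses (supreme∩minCut≡∅ S-min M-supreme R⊆T₂)) ]′ ]′
  (supreme-terminals M-supreme)
  where
  open ThresholdPartition G s∈T T₁-spec T₂-spec
  S-min : IsABMinCut G T₁ T₂ S
  S-min = proj₁ S-earliest
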